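{- For $n,k\ge1$, the number of order ideals of ${\sf C}_n\times[k]$ is $\sum_{i=1}^{k+1}i^n$.
   Context: The claw poset ${\sf C}_n=\{b_1,\dots,b_n,\widehat0\}$ has relations $\widehat0<b_i$ for all $i$ and no others; ${\sf C}_n\times[k]$ has the product order, $[k]=\{1<\dots<k\}$. -}

module Defs where

open import Data.Nat using (ℕ; zero; suc; _^_)
open import Data.Fin using (Fin) renaming (_≤_ to _≤ᶠ_)
open import Data.Maybe using (Maybe; just; nothing)
open import Data.Product using (_×_; _,_)
open import Data.Bool using (Bool; T)
open import Data.List using (map; applyUpTo)
open import Data.Nat.ListAction using (sum)
open import Level using (0ℓ)
open import Relation.Binary.Bundles using (Setoid)
open import Relation.Binary.PropositionalEquality using (_≡_; refl; sym; trans)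

-- The claw poset C_n = {b_1,…,b_n, 0̂}: 'nothing' is 0̂, 'just i' is b_{i+1}.
Claw : ℕ → Set
Claw n = Maybe (Fin n)

data _≤C_ {n : ℕ} : Claw n → Claw n → Set where
  bot≤  : ∀ {y} → nothing ≤C y
  b≤b   : ∀ {i} → just i ≤C just i

ClawProd : ℕ → ℕ → Set
ClawProd n k = Claw n × Fin k

_≤P_ : ∀ {n k} → ClawProd n k → ClawProd n k → Set
(c , i) ≤P (d , j) = (c ≤C d) × (i ≤ᶠ j)

record OrderIdeal (n k : ℕ) : Set where
  field
    mem  : ClawProd n k → Bool
    down : ∀ {x y} → y ≤P x → T (mem x) → T (mem y)
open OrderIdeal public

IdealSetoid : ℕ → ℕ → Setoid 0ℓ 0ℓ
IdealSetoid n k = record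
  { Carrier = OrderIdeal n k
  ; _≈_ = λ I J → ∀ x → mem I x ≡ mem J x
  ; isEquivalence = record
      { refl = λ x → refl
      ; sym = λ p x → sym (p x)
      ; trans = λ p q x → trans (p x) (q x) }
  }

powerSum : ℕ → ℕ → ℕ
powerSum n k = sum (map (λ i → i ^ n) (applyUpTo suc (suc k)))

{-# OPTIONS --safe #-}
module Submission where

open import Defs
open import Data.Nat using (ℕ; _≤_)
open import Data.Fin using (Fin)
open import Function.Bundles using (Bijection)
open import Relation.Binary.PropositionalEquality using (setoid)

open import Data.Bool using (Bool; true; false; T; if_then_else_)
open import Data.Empty using (⊥-elim)
open import Data.Fin using (zero; suc; toℕ; fromℕ<; funToFin; finToFun; combine)
  renaming (_≤_ to _≤ᶠ_)
open import Data.Fin.Properties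
  using (toℕ<n; toℕ-injective; toℕ-fromℕ<; +↔⊎; funToFin-finToFin; finToFun-funToFin)
  renaming (≤-refl to ≤ᶠ-refl)
open import Data.List using (map; applyUpTo)
open import Data.Maybe using (just; nothing)
open import Data.Nat using (zero; suc; _^_; _<ᵇ_; z≤n; s≤s; s≤s⁻¹)
open import Data.Nat.ListAction using (sum)
open import Data.Nat.Properties using (≤-refl; ≤-trans; <ᵇ⇒<; <⇒<ᵇ)
open import Data.Product using (Σ; _,_)
open import Data.Sum using (_⊎_; inj₁; inj₂)
open import Data.Sum.Function.Propositional using (_⊎-↔_)
open import Data.Unit using (tt)
open import Function.Base using (_∘_)
open import Function.Bundles using (Inverse; _↔_; mk↔ₛ′)
open import Function.Construct.Composition using (inverse; _↔-∘_)
open import Function.Construct.Identity using (↔-id)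
open import Function.Construct.Symmetry using (↔-sym)
open import Function.Properties.Inverse using (Inverse⇒Bijection)
open import Relation.Binary.PropositionalEquality
  using (_≡_; _≗_; refl; sym; trans; cong; cong₂; subst; module ≡-Reasoning)
open ≡-Reasoning

-- An order ideal of C_n × [k] is a family of down-closed columns {c} × [k], one for
-- each c ∈ C_n, so it is given by their heights h_c ∈ {0,…,k}; the only constraint is
-- h_{b_i} ≤ h_0̂. Choosing h_0̂ = a and then each h_{b_i} ∈ {0,…,a} gives
-- ∑_{a=0}^{k} (a+1)^n ideals.

DownClosed : ∀ {k} → (Fin k → Bool) → Set
DownClosed p = ∀ {i j} → i ≤ᶠ j → T (p j) → T (p i)

height : ∀ {k} → (Fin k → Bool) → Fin (suc k)
height {zero}  p = zero
height {suc k} p = if p zero then suc (height (p ∘ suc)) else zero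

below : ∀ {k} → ℕ → Fin k → Bool
below h j = toℕ j <ᵇ h

height-cong : ∀ {k} {p q : Fin k → Bool} → p ≗ q → height p ≡ height q
height-cong {zero}  e = refl
height-cong {suc k} e =
  cong₂ (λ b h → if b then suc h else zero) (e zero) (height-cong (e ∘ suc))

height-mono : ∀ {k} {p q : Fin k → Bool} →
              (∀ j → T (p j) → T (q j)) → toℕ (height p) ≤ toℕ (height q)
height-mono {zero} p⊆q = z≤n
height-mono {suc k} {p} {q} p⊆q with p zero | q zero | p⊆q zero
... | false | _     | _      = z≤n
... | true  | true  | _      = s≤s (height-mono (p⊆q ∘ suc))
... | true  | false | p0⇒q0 = ⊥-elim (p0⇒q0 tt)

height-below : ∀ {k} h → h ≤ k → toℕ (height (below {k} h)) ≡ h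
height-below {zero}  zero    z≤n       = refl
height-below {suc k} zero    z≤n       = refl
height-below {suc k} (suc h) (s≤s h≤k) = cong suc (height-below h h≤k)

below-height : ∀ {k} (p : Fin k → Bool) → DownClosed p → p ≗ below (toℕ (height p))
below-height {suc k} p down zero with p zero
... | true  = refl
... | false = refl
below-height {suc k} p down (suc j) with p zero in p0
... | true  = below-height (p ∘ suc) (down ∘ s≤s) j
... | false with p (suc j) in pj
...   | true  = ⊥-elim (subst T p0 (down {zero} {suc j} z≤n (subst T (sym pj) tt)))
...   | false = refl

below-mono : ∀ {k} {i j : Fin k} {h h′} →
             i ≤ᶠ j → h ≤ h′ → T (below h j) → T (below h′ i)
below-mono {j = j} {h} i≤j h≤h′ j<h =
  <⇒<ᵇ (≤-trans (s≤s i≤j) (≤-trans (<ᵇ⇒< (toℕ j) h j<h) h≤h′))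

≤C-refl : ∀ {n} (c : Claw n) → c ≤C c
≤C-refl nothing  = bot≤
≤C-refl (just i) = b≤b

-- (a , w) records the ideal whose 0̂-column has height a and whose b_i-column has
-- height finToFun w i ≤ a.
Code : ℕ → ℕ → Set
Code n k = Σ (Fin (suc k)) λ a → Fin (suc (toℕ a) ^ n)

funToFin-cong : ∀ {m n} {f g : Fin m → Fin n} → f ≗ g → funToFin f ≡ funToFin g
funToFin-cong {zero}  e = refl
funToFin-cong {suc m} e = cong₂ combine (e zero) (funToFin-cong (e ∘ suc))

module Ideals (n k : ℕ) where

  codeHeight : Code n k → Claw n → ℕ
  codeHeight (a , w) nothing  = toℕ a
  codeHeight (a , w) (just i) = toℕ (finToFun {suc (toℕ a)} w i)

  codeHeight-antitone : ∀ x {c d} → c ≤C d → codeHeight x d ≤ codeHeight x c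
  codeHeight-antitone (a , w) {d = nothing} bot≤ = ≤-refl
  codeHeight-antitone (a , w) {d = just i}  bot≤ = s≤s⁻¹ (toℕ<n (finToFun {suc (toℕ a)} w i))
  codeHeight-antitone x                     b≤b  = ≤-refl

  codeHeight≤k : ∀ x c → codeHeight x c ≤ k
  codeHeight≤k (a , w) c =
    ≤-trans (codeHeight-antitone (a , w) {d = c} bot≤) (s≤s⁻¹ (toℕ<n a))

  codeHeight-injective : ∀ {x y} → (∀ c → codeHeight x c ≡ codeHeight y c) → x ≡ y
  codeHeight-injective {a , w} {b , v} e with toℕ-injective (e nothing)
  ... | refl = cong (a ,_) (begin
    w                   ≡⟨ funToFin-finToFin {n} w ⟨
    funToFin (decode w) ≡⟨ funToFin-cong (λ i → toℕ-injective (e (just i))) ⟩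
    funToFin (decode v) ≡⟨ funToFin-finToFin {n} v ⟩
    v                   ∎)
    where
    decode : Fin (suc (toℕ a) ^ n) → Fin n → Fin (suc (toℕ a))
    decode = finToFun

  column : OrderIdeal n k → Claw n → Fin k → Bool
  column I c j = mem I (c , j)

  column-downClosed : ∀ I c → DownClosed (column I c)
  column-downClosed I c i≤j = down I (≤C-refl c , i≤j)

  apex : OrderIdeal n k → Fin (suc k)
  apex I = height (column I nothing)

  legs : (I : OrderIdeal n k) → Fin n → Fin (suc (toℕ (apex I)))
  legs I i =
    fromℕ< (s≤s (height-mono λ j → down I {just i , j} {nothing , j} (bot≤ , ≤ᶠ-refl)))

  toCode : OrderIdeal n k → Code n k
  toCode I = apex I , funToFin (legs I)

  codeHeight-toCode : ∀ I c → codeHeight (toCode I) c ≡ toℕ (height (column I c))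
  codeHeight-toCode I nothing  = refl
  codeHeight-toCode I (just i) =
    trans (cong toℕ (finToFun-funToFin (legs I) i)) (toℕ-fromℕ< _)

  fromCode : Code n k → OrderIdeal n k
  fromCode x = record
    { mem  = λ { (c , j) → below (codeHeight x c) j }
    ; down = λ { (c≤d , i≤j) → below-mono i≤j (codeHeight-antitone x c≤d) }
    }

  toCode-cong : ∀ {I J} → (∀ x → mem I x ≡ mem J x) → toCode I ≡ toCode J
  toCode-cong {I} {J} I≈J = codeHeight-injective λ c → begin
    codeHeight (toCode I) c       ≡⟨ codeHeight-toCode I c ⟩
    toℕ (height (column I c))     ≡⟨ cong toℕ (height-cong (λ j → I≈J (c , j))) ⟩
    toℕ (height (column J c))     ≡⟨ codeHeight-toCode J c ⟨
    codeHeight (toCode J) c       ∎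

  fromCode-cong : ∀ {x y} → x ≡ y → ∀ z → mem (fromCode x) z ≡ mem (fromCode y) z
  fromCode-cong refl z = refl

  toCode-fromCode : ∀ x → toCode (fromCode x) ≡ x
  toCode-fromCode x = codeHeight-injective λ c →
    trans (codeHeight-toCode (fromCode x) c) (height-below (codeHeight x c) (codeHeight≤k x c))

  fromCode-toCode : ∀ I y → mem (fromCode (toCode I)) y ≡ mem I y
  fromCode-toCode I (c , j) = begin
    below (codeHeight (toCode I) c) j    ≡⟨ cong (λ h → below h j) (codeHeight-toCode I c) ⟩
    below (toℕ (height (column I c))) j  ≡⟨ below-height (column I c) (column-downClosed I c) j ⟨
    mem I (c , j)                        ∎

  ideal↔code : Inverse (IdealSetoid n k) (setoid (Code n k))
  ideal↔code = record
    { to        = toCode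
    ; from      = fromCode
    ; to-cong   = λ {I} {J} → toCode-cong {I} {J}
    ; from-cong = fromCode-cong
    ; inverse   =
        (λ {x} {I} I≈x → trans (toCode-cong {I} {fromCode x} I≈x) (toCode-fromCode x))
      , (λ { {I} refl → fromCode-toCode I })
    }

Σ-Fin-suc↔ : ∀ {m} (P : Fin (suc m) → Set) →
             Σ (Fin (suc m)) P ↔ (P zero ⊎ Σ (Fin m) (P ∘ suc))
Σ-Fin-suc↔ P = mk↔ₛ′
  (λ { (zero , p) → inj₁ p ; (suc a , p) → inj₂ (a , p) })
  (λ { (inj₁ p) → zero , p ; (inj₂ (a , p)) → suc a , p })
  (λ { (inj₁ p) → refl ; (inj₂ (a , p)) → refl })
  (λ { (zero , p) → refl ; (suc a , p) → refl })

Fin-sum↔Σ : ∀ (f g : ℕ → ℕ) m →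
            Fin (sum (map f (applyUpTo g m))) ↔ Σ (Fin m) (λ a → Fin (f (g (toℕ a))))
Fin-sum↔Σ f g zero    = mk↔ₛ′ (λ ()) (λ ()) (λ ()) (λ ())
Fin-sum↔Σ f g (suc m) =
  ↔-sym (Σ-Fin-suc↔ _) ↔-∘ ((↔-id _ ⊎-↔ Fin-sum↔Σ f (g ∘ suc) m) ↔-∘ +↔⊎)

-- The bijection exists for all n and k.
proposition4p2 : (n k : ℕ) → 1 ≤ n → 1 ≤ k →
    Bijection (IdealSetoid n k) (setoid (Fin (powerSum n k)))
proposition4p2 n k _ _ =
  Inverse⇒Bijection
    (inverse (Ideals.ideal↔code n k) (↔-sym (Fin-sum↔Σ (_^ n) suc (suc k))))
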